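{- Let $k\geq 1$ and let $G$ be the sun graph on $m=8k$ vertices: its vertices are $v_0,\ldots,v_{4k-1}$ forming the cycle $v_0v_1\cdots v_{4k-1}v_0$, together with pendant vertices $u_0,\ldots,u_{4k-1}$, where $u_i$ is adjacent only to $v_i$. Define $a:V(G)\to\{0,\ldots,8k\}$ by $a(v_i)=i/2$ for $i$ even, $0\le i\le 2k-2$; $a(v_i)=8k-(i+1)/2$ for $i$ odd, $1\le i\le 2k-1$; $a(v_i)=i/2+2k-1$ for $i$ even, $2k\le i\le 4k-2$; $a(v_i)=6k-(i+1)/2$ for $i$ odd, $2k+1\le i\le 4k-1$; and $a(u_0)=8k$; $a(u_i)=6k-i/2$ for $i$ even, $2\le i\le 2k-2$; $a(u_i)=2k+(i-1)/2$ for $i$ odd, $1\le i\le 2k-3$; $a(u_{2k-1})=k$; $a(u_{2k})=5k$; $a(u_i)=8k-i/2$ for $i$ even, $2k+2\le i\le 4k-2$; $a(u_i)=(i+1)/2$ for $i$ odd, $2k+1\le i\le 4k-3$; $a(u_{4k-1})=4k-1$, where a case whose index range $a\le i\le b$ is empty (i.e. $a>b$) for the given $k$ is vacuous. Then $a$ is an $\alpha$-valuation of $G$.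
   Context: A $\beta$-valuation of a graph $G$ with $n$ edges is an injective map $b:V(G)\to\{0,1,\ldots,n\}$ such that the multiset $\{|b(u)-b(v)| : \{u,v\}\in E(G)\}$ equals $\{1,\ldots,n\}$. An $\alpha$-valuation is a $\beta$-valuation $b$ for which there exists an integer $x$, $0\le x\le n$, such that every edge $\{u,v\}$ satisfies $b(u)\le x<b(v)$ or $b(v)\le x<b(u)$. The sun graph here has $8k$ edges. -}

module Defs where

open import Data.Nat using (ℕ; zero; suc; _+_; _*_; _∸_; _≤_; _<_; ⌊_/2⌋; _≤ᵇ_; _≡ᵇ_; _%_)
open import Data.Nat.Properties using ()
open import Data.Bool using (Bool; true; false; if_then_else_)
open import Data.Fin using (Fin; toℕ)
open import Data.Fin as F using ()
open import Data.List using (List; []; _∷_; map; length; upTo; concatMap; allFin)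
open import Data.List.Relation.Binary.Permutation.Propositional using (_↭_)
open import Data.List.Relation.Unary.All using (All)
open import Data.Product using (_×_; _,_; Σ; ∃; proj₁; proj₂)
open import Data.Sum using (_⊎_)
open import Function.Definitions using (Injective)
open import Relation.Binary.PropositionalEquality using (_≡_)

dist : ℕ → ℕ → ℕ
dist x y = (x ∸ y) + (y ∸ x)

-- A finite graph given by a vertex type and its list of edges
-- (each edge an unordered pair, listed once as an ordered pair).
record Graph : Set₁ where
  field
    V     : Set
    edges : List (V × V)

open Graph public

numEdges : Graph → ℕ
numEdges G = length (edges G)

IsBetaValuation : (G : Graph) → (V G → ℕ) → Set
IsBetaValuation G b =
  Injective _≡_ _≡_ b
  × (∀ x → b x ≤ numEdges G)
  × (map (λ e → dist (b (proj₁ e)) (b (proj₂ e))) (edges G)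
       ↭ map suc (upTo (numEdges G)))

IsAlphaValuation : (G : Graph) → (V G → ℕ) → Set
IsAlphaValuation G b =
  IsBetaValuation G b
  × Σ ℕ (λ x → x ≤ numEdges G
      × All (λ e → (b (proj₁ e) ≤ x × x < b (proj₂ e))
                 ⊎ (b (proj₂ e) ≤ x × x < b (proj₁ e))) (edges G))

data SunV (n : ℕ) : Set where
  v : Fin n → SunV n
  u : Fin n → SunV n

cycSucc : {n : ℕ} → Fin n → Fin n
cycSucc {suc n} i = if toℕ i ≡ᵇ n then F.zero else F.fromℕ< {suc (toℕ i) % suc n} (Data.Nat.DivMod.m%n<n (suc (toℕ i)) (suc n))
  where import Data.Nat.DivMod

sunGraph : ℕ → Graph
sunGraph n = record
  { V = SunV n
  ; edges = concatMap (λ i → (v i , v (cycSucc i)) ∷ (v i , u i) ∷ []) (allFin n)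
  }

even : ℕ → Bool
even i = i % 2 ≡ᵇ 0

aV : ℕ → ℕ → ℕ
aV k i =
  if even i
  then (if i + 2 ≤ᵇ 2 * k then ⌊ i /2⌋ else ⌊ i /2⌋ + 2 * k ∸ 1)
  else (if i + 1 ≤ᵇ 2 * k then 8 * k ∸ ⌊ (i + 1) /2⌋ else 6 * k ∸ ⌊ (i + 1) /2⌋)

aU : ℕ → ℕ → ℕ
aU k i =
  if i ≡ᵇ 0 then 8 * k else
  if i ≡ᵇ 2 * k ∸ 1 then k else
  if i ≡ᵇ 2 * k then 5 * k else
  if i ≡ᵇ 4 * k ∸ 1 then 4 * k ∸ 1 else
  if even i
  then (if i + 2 ≤ᵇ 2 * k then 6 * k ∸ ⌊ i /2⌋ else 8 * k ∸ ⌊ i /2⌋)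
  else (if i + 3 ≤ᵇ 2 * k then 2 * k + ⌊ (i ∸ 1) /2⌋ else ⌊ (i + 1) /2⌋)

sunLabel : (k : ℕ) → SunV (4 * k) → ℕ
sunLabel k (v i) = aV k (toℕ i)
sunLabel k (u i) = aU k (toℕ i)

{-# OPTIONS --safe #-}
module Submission where

-- Write k = K + 1.  The indices i < 4k fall into eight kinds: the four indices 0, 2k − 1, 2k, 4k − 1
-- and the four progressions 2j + 2, 2j + 1, 2k + 2j + 2, 2k + 2j + 1 with j + r = K − 1.  On each kind
-- the labels of v_i, v_{i+1} and u_i, and hence the differences along v_i u_i and v_i v_{i+1}, are
-- linear in K, j and r.  Reading off these formulas: v_i carries a label ≤ 4k − 1 exactly when i is
-- even and u_i exactly when i is odd, and the cycle has even length, so every edge crosses the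
-- threshold 4k − 1.  The labels run through {0, …, 8k} ∖ {6k} and the differences through
-- {1, …, 8k}, each as a chain of arithmetic progressions; since there are 8k vertices and 8k edges,
-- counting turns these two coverings into injectivity of the labelling and into a permutation of
-- the differences.

open import Defs
open import Data.Nat using (ℕ; _≤_; _*_)

open import Data.Bool.Base using (Bool; true; false; not; if_then_else_)
open import Data.Bool.Properties using (not-involutive)
open import Data.Empty using (⊥-elim)
open import Data.Fin.Base as Fin using (Fin; toℕ; fromℕ<)
open import Data.Fin.Properties using (toℕ-fromℕ<; toℕ<n)
open import Data.List.Base using (List; []; _∷_; _++_; map; length; upTo; allFin; concatMap)
open import Data.List.Membership.Propositional using (_∈_)
open import Data.List.Membership.Propositional.Properties
  using (∈-∃++; ∈-map⁺; ∈-map⁻; ∈-allFin; ∈-++⁺ˡ; ∈-++⁺ʳ; ∈-upTo⁻; ∈-concatMap⁺)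
open import Data.List.Properties using (length-map; length-++; length-tabulate; length-upTo)
open import Data.List.Relation.Binary.Permutation.Propositional
  using (_↭_; ↭-refl; ↭-trans; ↭-sym; prep; ↭⇒↭ₛ)
open import Data.List.Relation.Binary.Permutation.Propositional.Properties using (shift; ∈-resp-↭; ↭-length)
import Data.List.Relation.Binary.Permutation.Setoid.Properties as ↭ₛ
open import Data.List.Relation.Binary.Subset.Propositional using (_⊆_)
open import Data.List.Relation.Unary.All as All using (All)
import Data.List.Relation.Unary.All.Properties as All
open import Data.List.Relation.Unary.AllPairs using (_∷_)
open import Data.List.Relation.Unary.Any as Any using (here; there)
open import Data.List.Relation.Unary.Unique.Propositional using (Unique)
open import Data.List.Relation.Unary.Unique.Propositional.Properties using (upTo⁺; map⁺; drop⁺)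
open import Data.Nat.Base
  using (zero; suc; _+_; _∸_; _<_; ⌊_/2⌋; _≤ᵇ_; _≡ᵇ_; _%_; z≤n; s≤s; s≤s⁻¹; z<s)
open import Data.Nat.DivMod using ([m+n]%n≡m%n; m<n⇒m%n≡m)
open import Data.Nat.Properties
open import Data.Nat.Tactic.RingSolver using (solve)
open import Data.Product.Base using (Σ; _×_; _,_; proj₁; proj₂)
open import Data.Sum.Base using (_⊎_; inj₁; inj₂)
open import Function.Base using (_∘_; id)
open import Function.Definitions using (Injective)
open import Relation.Binary.PropositionalEquality
open import Relation.Nullary.Decidable using (yes; no; dec-true; dec-false)

module _ {A : Set} where

  ⊆∧length⇒↭ : ∀ {xs ys : List A} → Unique ys → ys ⊆ xs → length xs ≡ length ys → xs ↭ ys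
  ⊆∧length⇒↭ {[]}    {[]}    _ _ _  = ↭-refl
  ⊆∧length⇒↭ {_ ∷ _} {[]}    _ _ ()
  ⊆∧length⇒↭ {xs}    {y ∷ ys} (y∉ys ∷ unique) ys⊆xs |xs|≡|ys|
    with as , bs , refl ← ∈-∃++ (ys⊆xs (here refl)) =
    ↭-trans (shift y as bs) (prep y (⊆∧length⇒↭ unique ys⊆as++bs |as++bs|≡|ys|))
    where
    ys⊆as++bs : ys ⊆ as ++ bs
    ys⊆as++bs z∈ys with ∈-resp-↭ (shift y as bs) (ys⊆xs (there z∈ys))
    ... | here refl = ⊥-elim (All.lookup y∉ys z∈ys refl)
    ... | there z∈  = z∈
    |as++bs|≡|ys| : length (as ++ bs) ≡ length ys
    |as++bs|≡|ys| = suc-injective (trans (sym (↭-length (shift y as bs))) |xs|≡|ys|)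

  Unique-resp-↭ : ∀ {xs ys : List A} → xs ↭ ys → Unique xs → Unique ys
  Unique-resp-↭ xs↭ys = ↭ₛ.Unique-resp-↭ (setoid A) (↭⇒↭ₛ xs↭ys)

  module _ {B : Set} (f : A → B) where

    unique-map⇒injective : ∀ {xs x y} → Unique (map f xs) → x ∈ xs → y ∈ xs → f x ≡ f y → x ≡ y
    unique-map⇒injective (_ ∷ _) (here refl) (here refl) _ = refl
    unique-map⇒injective (fx∉ ∷ _) (here refl) (there y∈) fx≡fy =
      ⊥-elim (All.lookup fx∉ (∈-map⁺ f y∈) fx≡fy)
    unique-map⇒injective (fy∉ ∷ _) (there x∈) (here refl) fx≡fy =
      ⊥-elim (All.lookup fy∉ (∈-map⁺ f x∈) (sym fx≡fy))
    unique-map⇒injective (_ ∷ unique) (there x∈) (there y∈) fx≡fy =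
      unique-map⇒injective unique x∈ y∈ fx≡fy

≤-by : ∀ {m n} d → m + d ≡ n → m ≤ n
≤-by {m} d refl = m≤m+n m d

∸-by : ∀ m n {d} → m ≡ n + d → m ∸ n ≡ d
∸-by _ n {d} refl = m+n∸m≡n n d

dist-by : ∀ {m n d} → m + d ≡ n → dist m n ≡ d
dist-by {m} {d = d} refl = trans (cong (_+ (m + d ∸ m)) (m≤n⇒m∸n≡0 (m≤m+n m d))) (m+n∸m≡n m d)

dist-by′ : ∀ {m n d} → n + d ≡ m → dist m n ≡ d
dist-by′ {m} {n} eq = trans (+-comm (m ∸ n) (n ∸ m)) (dist-by eq)

suc-+-comm : ∀ t s {n} → suc (t + s) ≡ n → suc (s + t) ≡ n
suc-+-comm t s = trans (cong suc (+-comm s t))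

≤ᵇ-true : ∀ {m n} → m ≤ n → (m ≤ᵇ n) ≡ true
≤ᵇ-true {m} {n} = dec-true (m ≤? n)

≤ᵇ-false : ∀ {m n} → n < m → (m ≤ᵇ n) ≡ false
≤ᵇ-false {m} {n} n<m = dec-false (m ≤? n) (<⇒≱ n<m)

≡ᵇ-true : ∀ {m n} → m ≡ n → (m ≡ᵇ n) ≡ true
≡ᵇ-true {m} {n} = dec-true (m ≟ n)

≡ᵇ-false : ∀ {m n} → m ≢ n → (m ≡ᵇ n) ≡ false
≡ᵇ-false {m} {n} = dec-false (m ≟ n)

if-true : ∀ {A : Set} {b} {x y : A} → b ≡ true → (if b then x else y) ≡ x
if-true refl = refl

if-false : ∀ {A : Set} {b} {x y : A} → b ≡ false → (if b then x else y) ≡ y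
if-false refl = refl

even-2+ : ∀ i → even (2 + i) ≡ even i
even-2+ i = cong (_≡ᵇ 0) (trans (cong (_% 2) (+-comm 2 i)) ([m+n]%n≡m%n i 2))

even-suc : ∀ i → even (suc i) ≡ not (even i)
even-suc zero    = refl
even-suc (suc i) = trans (even-2+ i) (trans (sym (not-involutive (even i))) (cong not (sym (even-suc i))))

even-2* : ∀ m → even (2 * m) ≡ true
even-2* zero    = refl
even-2* (suc m) = trans (cong even (*-suc 2 m)) (trans (even-2+ (2 * m)) (even-2* m))

even-1+2* : ∀ m → even (suc (2 * m)) ≡ false
even-1+2* m = trans (even-suc (2 * m)) (cong not (even-2* m))

1+2*m≢4*n : ∀ m n → suc (2 * m) ≢ 4 * n
1+2*m≢4*n m n eq = even≢odd (2 * n) m (sym (trans eq (*-assoc 2 2 n)))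

⌊2*n/2⌋≡n : ∀ n → ⌊ 2 * n /2⌋ ≡ n
⌊2*n/2⌋≡n zero    = refl
⌊2*n/2⌋≡n (suc n) = trans (cong ⌊_/2⌋ (*-suc 2 n)) (cong suc (⌊2*n/2⌋≡n n))

⌊[1+2*n]+1/2⌋≡1+n : ∀ n → ⌊ suc (2 * n) + 1 /2⌋ ≡ suc n
⌊[1+2*n]+1/2⌋≡1+n n =
  trans (cong ⌊_/2⌋ (trans (cong suc (+-comm (2 * n) 1)) (sym (*-suc 2 n)))) (⌊2*n/2⌋≡n (suc n))

data Parity : ℕ → Set where
  even-form : ∀ m → Parity (2 * m)
  odd-form  : ∀ m → Parity (suc (2 * m))

parity : ∀ n → Parity n
parity zero = even-form 0
parity (suc n) with parity n
... | even-form m = odd-form m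
... | odd-form m  = subst Parity (*-suc 2 m) (even-form (suc m))

2*n≡n+n : ∀ n → 2 * n ≡ n + n
2*n≡n+n n = cong (n +_) (+-identityʳ n)

data Half (K : ℕ) : ℕ → Set where
  lower : ∀ j r → j + r ≡ K → Half K j
  upper : ∀ j r → j + r ≡ K → Half K (j + suc K)

half : ∀ K {m} → m < 2 * suc K → Half K m
half K {m} m<2k with m <? suc K
... | yes m<k with r , eq ← m≤n⇒∃[o]m+o≡n m<k = lower m r (suc-injective eq)
... | no  m≮k with j , refl ← m≤n⇒∃[o]m+o≡n (≮⇒≥ m≮k)
  with r , eq ← m≤n⇒∃[o]m+o≡n (+-cancelˡ-< (suc K) j (suc K) (subst (suc K + j <_) (2*n≡n+n (suc K)) m<2k)) =
  subst (Half K) (+-comm j (suc K)) (upper j r (suc-injective eq))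

halve-< : ∀ K m → 2 * m < 4 * suc K → m < 2 * suc K
halve-< K m 2m<4k = *-cancelˡ-< 2 m (2 * suc K) (subst (2 * m <_) (*-assoc 2 2 (suc K)) 2m<4k)

-- Covering intervals of ℕ

Range : (ℕ → Set) → ℕ → ℕ → Set
Range P a b = ∀ d → a ≤ d → d < b → P d

module _ {P : ℕ → Set} where

  infixr 5 _⟫_

  _⟫_ : ∀ {a b c} → Range P a b → Range P b c → Range P a c
  _⟫_ {b = b} left right d a≤d d<c with d <? b
  ... | yes d<b = left d a≤d d<b
  ... | no  d≮b = right d (≮⇒≥ d≮b) d<c

  range-point : ∀ {a} → P a → Range P a (1 + a)
  range-point Pa d a≤d d<1+a = subst P (≤-antisym a≤d (s≤s⁻¹ d<1+a)) Pa

  range-interval : ∀ a b n → a + n ≡ b → (∀ t s → suc (t + s) ≡ n → P (a + t)) → Range P a b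
  range-interval a _ n refl Pa+ d a≤d d<b
    with t , refl ← m≤n⇒∃[o]m+o≡n a≤d
    with s , t+s<n ← m≤n⇒∃[o]m+o≡n (+-cancelˡ-< a t n d<b) = Pa+ t s t+s<n

  range-pairs : ∀ a b n → a + 2 * n ≡ b →
                (∀ t s → suc (t + s) ≡ n → P (a + 2 * t) × P (suc (a + 2 * t))) → Range P a b
  range-pairs a _ n refl Pa+ d a≤d d<b
    with t , refl ← m≤n⇒∃[o]m+o≡n a≤d
    with parity t | +-cancelˡ-< a t (2 * n) d<b
  ... | even-form m | 2m<2n
    with s , eq ← m≤n⇒∃[o]m+o≡n (*-cancelˡ-< 2 m n 2m<2n) = proj₁ (Pa+ m s eq)
  ... | odd-form m | 1+2m<2n
    with s , eq ← m≤n⇒∃[o]m+o≡n (*-cancelˡ-< 2 m n (<-trans (n<1+n (2 * m)) 1+2m<2n)) =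
    subst P (sym (+-suc a (2 * m))) (proj₂ (Pa+ m s eq))

vertices : ∀ n → List (SunV n)
vertices n = map v (allFin n) ++ map u (allFin n)

∈-vertices : ∀ {n} (x : SunV n) → x ∈ vertices n
∈-vertices     (v i) = ∈-++⁺ˡ (∈-map⁺ v (∈-allFin i))
∈-vertices {n} (u i) = ∈-++⁺ʳ (map v (allFin n)) (∈-map⁺ u (∈-allFin i))

length-allFin : ∀ n → length (allFin n) ≡ n
length-allFin n = length-tabulate {n = n} id

length-vertices : ∀ n → length (vertices n) ≡ n + n
length-vertices n = trans (length-++ (map v (allFin n)))
  (cong₂ _+_ (trans (length-map v (allFin n)) (length-allFin n)) (trans (length-map u (allFin n)) (length-allFin n)))

length-concatMap-pair : ∀ {A B : Set} (f g : A → B) xs →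
                        length (concatMap (λ x → f x ∷ g x ∷ []) xs) ≡ 2 * length xs
length-concatMap-pair f g []       = refl
length-concatMap-pair f g (x ∷ xs) = trans (cong (2 +_) (length-concatMap-pair f g xs)) (sym (*-suc 2 (length xs)))

numEdges-sunGraph : ∀ n → numEdges (sunGraph n) ≡ 2 * n
numEdges-sunGraph n = trans (length-concatMap-pair _ _ (allFin n)) (cong (2 *_) (length-allFin n))

cycle-edge∈ : ∀ {n} (i : Fin n) → (v i , v (cycSucc i)) ∈ edges (sunGraph n)
cycle-edge∈ i = ∈-concatMap⁺ _ (Any.map (λ { refl → here refl }) (∈-allFin i))

pendant-edge∈ : ∀ {n} (i : Fin n) → (v i , u i) ∈ edges (sunGraph n)
pendant-edge∈ i = ∈-concatMap⁺ _ (Any.map (λ { refl → there (here refl) }) (∈-allFin i))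

all-edges : ∀ {n} {P : SunV n × SunV n → Set} →
            (∀ i → P (v i , v (cycSucc i)) × P (v i , u i)) → All P (edges (sunGraph n))
all-edges P-at =
  All.concat⁺ (All.map⁺ (All.tabulate⁺ λ i → proj₁ (P-at i) All.∷ proj₂ (P-at i) All.∷ All.[]))

toℕ-cycSucc : ∀ {m} (i : Fin (suc m)) → toℕ i ≢ m → toℕ (cycSucc i) ≡ suc (toℕ i)
toℕ-cycSucc i i≢m =
  trans (cong toℕ (if-false (≡ᵇ-false i≢m)))
        (trans (toℕ-fromℕ< _) (m<n⇒m%n≡m (s≤s (≤∧≢⇒< (s≤s⁻¹ (toℕ<n i)) i≢m))))

toℕ-cycSucc-fromℕ< : ∀ {m i} (i<1+m : i < suc m) → suc i ≢ suc m → toℕ (cycSucc (fromℕ< i<1+m)) ≡ suc i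
toℕ-cycSucc-fromℕ< i<1+m 1+i≢1+m =
  trans (toℕ-cycSucc _ λ eq → 1+i≢1+m (cong suc (trans (sym (toℕ-fromℕ< i<1+m)) eq)))
        (cong suc (toℕ-fromℕ< i<1+m))

cycSucc-last : ∀ {m} (i : Fin (suc m)) → toℕ i ≡ m → cycSucc i ≡ Fin.zero
cycSucc-last i i≡m = if-true (≡ᵇ-true i≡m)

even-cycSucc : ∀ {m} (i : Fin (suc m)) → even m ≡ false → even (toℕ (cycSucc i)) ≡ not (even (toℕ i))
even-cycSucc {m} i m-odd with toℕ i ≟ m
... | yes i≡m =
  trans (cong (even ∘ toℕ) (cycSucc-last i i≡m)) (sym (trans (cong (not ∘ even) i≡m) (cong not m-odd)))
... | no  i≢m = trans (cong even (toℕ-cycSucc i i≢m)) (even-suc (toℕ i))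

-- The labelling in closed form

aV-even-low : ∀ k m d → 2 * m + 2 + d ≡ 2 * k → aV k (2 * m) ≡ m
aV-even-low k m d eq = trans (if-true (even-2* m)) (trans (if-true (≤ᵇ-true (≤-by d eq))) (⌊2*n/2⌋≡n m))

aV-even-high : ∀ k m d → suc (2 * k) + d ≡ 2 * m + 2 → aV k (2 * m) ≡ m + 2 * k ∸ 1
aV-even-high k m d eq =
  trans (if-true (even-2* m))
        (trans (if-false (≤ᵇ-false (≤-by d eq))) (cong (λ h → h + 2 * k ∸ 1) (⌊2*n/2⌋≡n m)))

aV-odd-low : ∀ k m d → suc (2 * m) + 1 + d ≡ 2 * k → aV k (suc (2 * m)) ≡ 8 * k ∸ suc m
aV-odd-low k m d eq =
  trans (if-false (even-1+2* m))
        (trans (if-true (≤ᵇ-true (≤-by d eq))) (cong (8 * k ∸_) (⌊[1+2*n]+1/2⌋≡1+n m)))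

aV-odd-high : ∀ k m d → suc (2 * k) + d ≡ suc (2 * m) + 1 → aV k (suc (2 * m)) ≡ 6 * k ∸ suc m
aV-odd-high k m d eq =
  trans (if-false (even-1+2* m))
        (trans (if-false (≤ᵇ-false (≤-by d eq))) (cong (6 * k ∸_) (⌊[1+2*n]+1/2⌋≡1+n m)))

-- The exceptional indices 2k − 1 and 4k − 1 are odd, so an even index can only clash with 0 and 2k.
-- As k = K + 1, suc (2k ∸ 1) and suc (4k ∸ 1) compute to 2k and 4k, which removes the truncation.
aU-even : ∀ K m → 2 * m ≢ 0 → 2 * m ≢ 2 * suc K →
          aU (suc K) (2 * m) ≡ (if 2 * m + 2 ≤ᵇ 2 * suc K then 6 * suc K ∸ m else 8 * suc K ∸ m)
aU-even K m ≢0 ≢2k =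
  trans (if-false (≡ᵇ-false ≢0))
  (trans (if-false (≡ᵇ-false λ eq → even≢odd (suc K) m (sym (cong suc eq))))
  (trans (if-false (≡ᵇ-false ≢2k))
  (trans (if-false (≡ᵇ-false λ eq → even≢odd (2 * suc K) m (trans (sym (*-assoc 2 2 (suc K))) (sym (cong suc eq)))))
  (trans (if-true (even-2* m))
  (cong (λ h → if 2 * m + 2 ≤ᵇ 2 * suc K then 6 * suc K ∸ h else 8 * suc K ∸ h) (⌊2*n/2⌋≡n m))))))

aU-odd : ∀ K m → suc (suc (2 * m)) ≢ 2 * suc K → suc (suc (2 * m)) ≢ 4 * suc K →
         aU (suc K) (suc (2 * m)) ≡ (if suc (2 * m) + 3 ≤ᵇ 2 * suc K then 2 * suc K + m else suc m)
aU-odd K m ≢2k ≢4k =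
  trans (if-false (≡ᵇ-false (≢2k ∘ cong suc)))
  (trans (if-false (≡ᵇ-false λ eq → even≢odd (suc K) m (sym eq)))
  (trans (if-false (≡ᵇ-false (≢4k ∘ cong suc)))
  (trans (if-false (even-1+2* m))
  (cong₂ (λ h h′ → if suc (2 * m) + 3 ≤ᵇ 2 * suc K then 2 * suc K + h else h′)
         (⌊2*n/2⌋≡n m) (⌊[1+2*n]+1/2⌋≡1+n m)))))

aU-even-low : ∀ K m d → 2 * suc m + 2 + d ≡ 2 * suc K → aU (suc K) (2 * suc m) ≡ 6 * suc K ∸ suc m
aU-even-low K m d eq = trans (aU-even K (suc m) (λ ()) (<⇒≢ i<2k)) (if-true (≤ᵇ-true i+2≤2k))
  where
  i+2≤2k : 2 * suc m + 2 ≤ 2 * suc K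
  i+2≤2k = ≤-by d eq
  i<2k : 2 * suc m < 2 * suc K
  i<2k = <-≤-trans (m<m+n (2 * suc m) z<s) i+2≤2k

aU-even-high : ∀ K m d → suc (2 * suc K) + d ≡ 2 * m → aU (suc K) (2 * m) ≡ 8 * suc K ∸ m
aU-even-high K m d eq =
  trans (aU-even K m i≢0 (>⇒≢ 2k<i)) (if-false (≤ᵇ-false (<-≤-trans 2k<i (m≤m+n (2 * m) 2))))
  where
  2k<i : 2 * suc K < 2 * m
  2k<i = ≤-by d eq
  i≢0 : 2 * m ≢ 0
  i≢0 i≡0 = n≮0 (subst (2 * suc K <_) i≡0 2k<i)

aU-odd-low : ∀ K m d → suc (2 * m) + 3 + d ≡ 2 * suc K → aU (suc K) (suc (2 * m)) ≡ 2 * suc K + m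
aU-odd-low K m d eq =
  trans (aU-odd K m (<⇒≢ i+1<2k) (<⇒≢ (<-≤-trans i+1<2k 2k≤4k))) (if-true (≤ᵇ-true (≤-by d eq)))
  where
  rearrange : 3 + 2 * m + suc d ≡ suc (2 * m) + 3 + d
  rearrange = solve (m ∷ d ∷ [])
  i+1<2k : 2 + 2 * m < 2 * suc K
  i+1<2k = ≤-by (suc d) (trans rearrange eq)
  2k≤4k : 2 * suc K ≤ 4 * suc K
  2k≤4k = ≤-by (2 * suc K) (solve (K ∷ []))

aU-odd-high : ∀ K m d d′ → suc (2 * suc K) + d ≡ suc (2 * m) → 3 + 2 * m + d′ ≡ 4 * suc K →
              aU (suc K) (suc (2 * m)) ≡ suc m
aU-odd-high K m d d′ eq eq′ =
  trans (aU-odd K m (>⇒≢ (<-trans 2k<i (n<1+n _))) (<⇒≢ (≤-by d′ eq′)))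
        (if-false (≤ᵇ-false (<-≤-trans 2k<i (m≤m+n _ 3))))
  where
  2k<i : 2 * suc K < suc (2 * m)
  2k<i = ≤-by d eq

aU-2k-1 : ∀ K → aU (suc K) (suc (2 * K)) ≡ suc K
aU-2k-1 K = if-true (≡ᵇ-true i≡2k∸1)
  where
  i≡2k∸1 : suc (2 * K) ≡ 2 * suc K ∸ 1
  i≡2k∸1 = suc-injective (sym (*-suc 2 K))

aU-2k : ∀ K → aU (suc K) (2 * suc K) ≡ 5 * suc K
aU-2k K = trans (if-false (≡ᵇ-false i≢2k∸1)) (if-true (≡ᵇ-true {2 * suc K} refl))
  where
  i≢2k∸1 : 2 * suc K ≢ 2 * suc K ∸ 1
  i≢2k∸1 = 1+n≢n ∘ cong suc

1+[4k-1]≡4k : ∀ K → 2 + 2 * (K + suc K) ≡ 4 * suc K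
1+[4k-1]≡4k K = solve (K ∷ [])

aU-4k-1 : ∀ K → aU (suc K) (suc (2 * (K + suc K))) ≡ 3 + 4 * K
aU-4k-1 K =
  trans (if-false (≡ᵇ-false i≢2k∸1))
  (trans (if-false (≡ᵇ-false i≢2k))
  (trans (if-true (≡ᵇ-true (suc-injective (1+[4k-1]≡4k K))))
  4k∸1≡3+4K))
  where
  2k<1+i : 2 * suc K < 2 + 2 * (K + suc K)
  2k<1+i = ≤-by (2 * K + 1) (solve (K ∷ []))
  i≢2k∸1 : suc (2 * (K + suc K)) ≢ 2 * suc K ∸ 1
  i≢2k∸1 eq = >⇒≢ 2k<1+i (cong suc eq)
  i≢2k : suc (2 * (K + suc K)) ≢ 2 * suc K
  i≢2k = even≢odd (suc K) (K + suc K) ∘ sym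
  4k∸1≡3+4K : 4 * suc K ∸ 1 ≡ 3 + 4 * K
  4k∸1≡3+4K = ∸-by (4 * suc K) 1 (solve (K ∷ []))

-- Distances are carried as explicit offsets, so that every entry of Row is checked by a ring identity.
data Dist (m n : ℕ) : ℕ → Set where
  up   : ∀ {d} → m + d ≡ n → Dist m n d
  down : ∀ {d} → n + d ≡ m → Dist m n d

Dist⇒dist : ∀ {m n d} → Dist m n d → dist m n ≡ d
Dist⇒dist (up eq)   = dist-by eq
Dist⇒dist (down eq) = dist-by′ eq

data Side (t : ℕ) : Bool → ℕ → Set where
  below : ∀ {a} d → a + d ≡ t → Side t true a
  above : ∀ {a} d → suc t + d ≡ a → Side t false a

-- Row K i x x′ y p c, for k = K + 1: v_i is labelled x, its cycle successor x′ and u_i y, and the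
-- edges v_i u_i and v_i v_{i+1} have differences p and c.
data Row (K : ℕ) : (i x x′ y p c : ℕ) → Set where
  first      : Row K 0 0 (7 + 8 * K) (8 + 8 * K) (8 + 8 * K) (7 + 8 * K)
  evenLow    : ∀ j r → suc (j + r) ≡ K →
               Row K (2 * suc j) (suc j) (7 + 7 * K + r) (6 + 5 * K + r) (6 + 4 * K + 2 * r) (7 + 6 * K + 2 * r)
  oddLow     : ∀ j r → suc (j + r) ≡ K →
               Row K (suc (2 * j)) (8 + 7 * K + r) (suc j) (2 + 2 * K + j) (7 + 4 * K + 2 * r) (8 + 6 * K + 2 * r)
  middleOdd  : Row K (suc (2 * K)) (7 + 7 * K) (2 + 3 * K) (1 + K) (6 + 6 * K) (5 + 4 * K)
  middleEven : Row K (2 * suc K) (2 + 3 * K) (4 + 5 * K) (5 + 5 * K) (3 + 2 * K) (2 + 2 * K)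
  evenHigh   : ∀ j r → suc (j + r) ≡ K →
               Row K (2 * (suc j + suc K)) (3 + 3 * K + j) (4 + 4 * K + r) (7 + 6 * K + r) (5 + 2 * K + 2 * r) (2 + 2 * r)
  oddHigh    : ∀ j r → suc (j + r) ≡ K →
               Row K (suc (2 * (j + suc K))) (5 + 4 * K + r) (3 + 3 * K + j) (2 + K + j) (4 + 2 * K + 2 * r) (3 + 2 * r)
  last       : Row K (suc (2 * (K + suc K))) (4 + 4 * K) 0 (3 + 4 * K) 1 (4 + 4 * K)

next-index : ∀ {K i x x′ y p c} → Row K i x x′ y p c → ℕ
next-index last      = 0
next-index {i = i} _ = suc i

row-offset : ∀ {K i x x′ y p c} → Row K i x x′ y p c → Σ ℕ λ d → suc i + d ≡ 4 * suc K
row-offset {K} first           = 3 + 4 * K , solve (K ∷ [])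
row-offset (evenLow j r refl)  = 2 * j + 4 * r + 5 , solve (j ∷ r ∷ [])
row-offset (oddLow j r refl)   = 2 * j + 4 * r + 6 , solve (j ∷ r ∷ [])
row-offset {K} middleOdd       = 2 * K + 2 , solve (K ∷ [])
row-offset {K} middleEven      = 2 * K + 1 , solve (K ∷ [])
row-offset (evenHigh j r refl) = 2 * r + 1 , solve (j ∷ r ∷ [])
row-offset (oddHigh j r refl)  = 2 * r + 2 , solve (j ∷ r ∷ [])
row-offset {K} last            = 0 , solve (K ∷ [])

row-< : ∀ {K i x x′ y p c} → Row K i x x′ y p c → i < 4 * suc K
row-< ρ = let d , eq = row-offset ρ in ≤-by d eq

row-aV : ∀ {K i x x′ y p c} → Row K i x x′ y p c → aV (suc K) i ≡ x
row-aV {K} first = aV-even-low (suc K) 0 (2 * K) (solve (K ∷ []))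
row-aV (evenLow j r refl) = aV-even-low (2 + (j + r)) (suc j) (2 * r) (solve (j ∷ r ∷ []))
row-aV (oddLow j r refl) =
  trans (aV-odd-low (2 + (j + r)) j (2 * r + 2) (solve (j ∷ r ∷ [])))
        (∸-by (8 * (2 + (j + r))) (suc j) (solve (j ∷ r ∷ [])))
row-aV {K} middleOdd =
  trans (aV-odd-low (suc K) K 0 (solve (K ∷ []))) (∸-by (8 * suc K) (suc K) (solve (K ∷ [])))
row-aV {K} middleEven =
  trans (aV-even-high (suc K) (suc K) 1 (solve (K ∷ []))) (∸-by (suc K + 2 * suc K) 1 (solve (K ∷ [])))
row-aV (evenHigh j r refl) =
  trans (aV-even-high (2 + (j + r)) (suc j + (2 + (j + r))) (2 * j + 3) (solve (j ∷ r ∷ [])))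
        (∸-by (suc j + (2 + (j + r)) + 2 * (2 + (j + r))) 1 (solve (j ∷ r ∷ [])))
row-aV (oddHigh j r refl) =
  trans (aV-odd-high (2 + (j + r)) (j + (2 + (j + r))) (2 * j + 1) (solve (j ∷ r ∷ [])))
        (∸-by (6 * (2 + (j + r))) (suc (j + (2 + (j + r)))) (solve (j ∷ r ∷ [])))
row-aV {K} last =
  trans (aV-odd-high (suc K) (K + suc K) (2 * K + 1) (solve (K ∷ [])))
        (∸-by (6 * suc K) (suc (K + suc K)) (solve (K ∷ [])))

row-aV-next : ∀ {K i x x′ y p c} (ρ : Row K i x x′ y p c) → aV (suc K) (next-index ρ) ≡ x′
row-aV-next {K} first =
  trans (aV-odd-low (suc K) 0 (2 * K) (solve (K ∷ []))) (∸-by (8 * suc K) 1 (solve (K ∷ [])))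
row-aV-next (evenLow j r refl) =
  trans (aV-odd-low (2 + (j + r)) (suc j) (2 * r) (solve (j ∷ r ∷ [])))
        (∸-by (8 * (2 + (j + r))) (2 + j) (solve (j ∷ r ∷ [])))
row-aV-next {K} (oddLow j r e) = trans (cong (aV (suc K)) (sym (*-suc 2 j))) (row-aV (evenLow j r e))
row-aV-next {K} middleOdd = trans (cong (aV (suc K)) (sym (*-suc 2 K))) (row-aV {K} middleEven)
row-aV-next {K} middleEven =
  trans (aV-odd-high (suc K) (suc K) 1 (solve (K ∷ []))) (∸-by (6 * suc K) (2 + K) (solve (K ∷ [])))
row-aV-next (evenHigh j r refl) =
  trans (aV-odd-high (2 + (j + r)) (suc j + (2 + (j + r))) (2 * j + 3) (solve (j ∷ r ∷ [])))
        (∸-by (6 * (2 + (j + r))) (suc (suc j + (2 + (j + r)))) (solve (j ∷ r ∷ [])))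
row-aV-next {K} (oddHigh j r e) =
  trans (cong (aV (suc K)) (sym (*-suc 2 (j + suc K)))) (row-aV (evenHigh j r e))
row-aV-next {K} last = row-aV {K} first

row-aU : ∀ {K i x x′ y p c} → Row K i x x′ y p c → aU (suc K) i ≡ y
row-aU {K} first = *-suc 8 K
row-aU (evenLow j r refl) =
  trans (aU-even-low (suc (j + r)) j (2 * r) (solve (j ∷ r ∷ [])))
        (∸-by (6 * (2 + (j + r))) (suc j) (solve (j ∷ r ∷ [])))
row-aU (oddLow j r refl) =
  trans (aU-odd-low (suc (j + r)) j (2 * r) (solve (j ∷ r ∷ []))) (cong (_+ j) (*-suc 2 (suc (j + r))))
row-aU {K} middleOdd  = aU-2k-1 K
row-aU {K} middleEven = trans (aU-2k K) (*-suc 5 K)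
row-aU (evenHigh j r refl) =
  trans (aU-even-high (suc (j + r)) (suc j + (2 + (j + r))) (2 * j + 1) (solve (j ∷ r ∷ [])))
        (∸-by (8 * (2 + (j + r))) (suc j + (2 + (j + r))) (solve (j ∷ r ∷ [])))
row-aU (oddHigh j r refl) =
  trans (aU-odd-high (suc (j + r)) (j + (2 + (j + r))) (2 * j) (2 * r + 1)
                     (solve (j ∷ r ∷ [])) (solve (j ∷ r ∷ [])))
        (cong suc (+-comm j (2 + (j + r))))
row-aU {K} last = aU-4k-1 K

row-gaps : ∀ {K i x x′ y p c} → Row K i x x′ y p c → Dist x y p × Dist x x′ c
row-gaps first               = up refl , up refl
row-gaps (evenLow j r refl)  = up (solve (j ∷ r ∷ [])) , up (solve (j ∷ r ∷ []))
row-gaps (oddLow j r refl)   = down (solve (j ∷ r ∷ [])) , down (solve (j ∷ r ∷ []))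
row-gaps {K} middleOdd       = down (solve (K ∷ [])) , down (solve (K ∷ []))
row-gaps {K} middleEven      = up (solve (K ∷ [])) , up (solve (K ∷ []))
row-gaps (evenHigh j r refl) = up (solve (j ∷ r ∷ [])) , up (solve (j ∷ r ∷ []))
row-gaps (oddHigh j r refl)  = down (solve (j ∷ r ∷ [])) , down (solve (j ∷ r ∷ []))
row-gaps {K} last            = down (solve (K ∷ [])) , down (solve (K ∷ []))

row-sides : ∀ {K i x x′ y p c} → Row K i x x′ y p c →
            Side (3 + 4 * K) (even i) x × Side (3 + 4 * K) (not (even i)) y
row-sides {K} first = below (3 + 4 * K) refl , above (4 + 4 * K) (solve (K ∷ []))
row-sides (evenLow j r refl) rewrite even-2* (suc j) =
  below (3 * j + 4 * r + 6) (solve (j ∷ r ∷ [])) , above (3 + (j + r) + r) (solve (j ∷ r ∷ []))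
row-sides (oddLow j r refl) rewrite even-1+2* j =
  above (7 + 3 * (j + r) + r) (solve (j ∷ r ∷ [])) , below (3 + (j + r) + r) (solve (j ∷ r ∷ []))
row-sides {K} middleOdd rewrite even-1+2* K =
  above (3 + 3 * K) (solve (K ∷ [])) , below (2 + 3 * K) (solve (K ∷ []))
row-sides {K} middleEven rewrite even-2* (suc K) =
  below (1 + K) (solve (K ∷ [])) , above (1 + K) (solve (K ∷ []))
row-sides (evenHigh j r refl) rewrite even-2* (suc j + (2 + (j + r))) =
  below (1 + r) (solve (j ∷ r ∷ [])) , above (5 + 2 * (j + r) + r) (solve (j ∷ r ∷ []))
row-sides (oddHigh j r refl) rewrite even-1+2* (j + (2 + (j + r))) =
  above (1 + r) (solve (j ∷ r ∷ [])) , below (4 + 2 * (j + r) + r) (solve (j ∷ r ∷ []))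
row-sides {K} last rewrite even-1+2* (K + suc K) =
  above 0 (solve (K ∷ [])) , below 0 (solve (K ∷ []))

row-cycSucc : ∀ {K i x x′ y p c} (ρ : Row K i x x′ y p c) → toℕ (cycSucc (fromℕ< (row-< ρ))) ≡ next-index ρ
row-cycSucc {K} ρ@first            = toℕ-cycSucc-fromℕ< (row-< ρ) (1+2*m≢4*n 0 (suc K))
row-cycSucc {K} ρ@(evenLow j r _)  = toℕ-cycSucc-fromℕ< (row-< ρ) (1+2*m≢4*n (suc j) (suc K))
row-cycSucc {K} ρ@(oddLow j r e)   =
  toℕ-cycSucc-fromℕ< (row-< ρ) (<⇒≢ (subst (_< 4 * suc K) (*-suc 2 j) (row-< (evenLow j r e))))
row-cycSucc {K} ρ@middleOdd        =
  toℕ-cycSucc-fromℕ< (row-< ρ) (<⇒≢ (subst (_< 4 * suc K) (*-suc 2 K) (row-< {K} middleEven)))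
row-cycSucc {K} ρ@middleEven       = toℕ-cycSucc-fromℕ< (row-< ρ) (1+2*m≢4*n (suc K) (suc K))
row-cycSucc {K} ρ@(evenHigh j r _) = toℕ-cycSucc-fromℕ< (row-< ρ) (1+2*m≢4*n (suc j + suc K) (suc K))
row-cycSucc {K} ρ@(oddHigh j r e)  =
  toℕ-cycSucc-fromℕ< (row-< ρ) (<⇒≢ (subst (_< 4 * suc K) (*-suc 2 (j + suc K)) (row-< (evenHigh j r e))))
row-cycSucc {K} ρ@last             =
  cong toℕ (cycSucc-last (fromℕ< (row-< ρ)) (trans (toℕ-fromℕ< (row-< ρ)) (suc-injective (1+[4k-1]≡4k K))))

-- Covering the labels and the differences

labelList : ℕ → List ℕ
labelList K = map (sunLabel (suc K)) (vertices (4 * suc K))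

gapList : ℕ → List ℕ
gapList K = map (λ e → dist (sunLabel (suc K) (proj₁ e)) (sunLabel (suc K) (proj₂ e))) (edges (sunGraph (4 * suc K)))

module _ (K : ℕ) {i x x′ y p c : ℕ} (ρ : Row K i x x′ y p c) where

  private
    vᵢ = fromℕ< (row-< ρ)

  row-v∈ : x ∈ labelList K
  row-v∈ = subst (_∈ labelList K) (trans (cong (aV (suc K)) (toℕ-fromℕ< (row-< ρ))) (row-aV ρ))
                 (∈-map⁺ (sunLabel (suc K)) (∈-vertices (v vᵢ)))

  row-u∈ : y ∈ labelList K
  row-u∈ = subst (_∈ labelList K) (trans (cong (aU (suc K)) (toℕ-fromℕ< (row-< ρ))) (row-aU ρ))
                 (∈-map⁺ (sunLabel (suc K)) (∈-vertices (u vᵢ)))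

  row-pendant∈ : p ∈ gapList K
  row-pendant∈ = subst (_∈ gapList K) gap≡p (∈-map⁺ _ (pendant-edge∈ vᵢ))
    where
    gap≡p : dist (aV (suc K) (toℕ vᵢ)) (aU (suc K) (toℕ vᵢ)) ≡ p
    gap≡p = trans (cong (λ i → dist (aV (suc K) i) (aU (suc K) i)) (toℕ-fromℕ< (row-< ρ)))
                  (trans (cong₂ dist (row-aV ρ) (row-aU ρ)) (Dist⇒dist (proj₁ (row-gaps ρ))))

  row-cycle∈ : c ∈ gapList K
  row-cycle∈ = subst (_∈ gapList K) gap≡c (∈-map⁺ _ (cycle-edge∈ vᵢ))
    where
    gap≡c : dist (aV (suc K) (toℕ vᵢ)) (aV (suc K) (toℕ (cycSucc vᵢ))) ≡ c
    gap≡c = trans (cong₂ (λ i i′ → dist (aV (suc K) i) (aV (suc K) i′))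
                         (toℕ-fromℕ< (row-< ρ)) (row-cycSucc ρ))
                  (trans (cong₂ dist (row-aV ρ) (row-aV-next ρ)) (Dist⇒dist (proj₂ (row-gaps ρ))))

-- 6k is the only number in {0, …, 8k} that is not a label.
labels-cover : ∀ K → Range (_∈ 6 + 6 * K ∷ labelList K) 0 (9 + 8 * K)
labels-cover K =
     range-point (there (row-v∈ K first))
  ⟫ range-interval 1 (1 + K) K refl (λ t s e → there (row-v∈ K (evenLow t s e)))
  ⟫ range-point (there (row-u∈ K middleOdd))
  ⟫ range-interval (2 + K) (2 + 2 * K) K (solve (K ∷ [])) (λ t s e → there (row-u∈ K (oddHigh t s e)))
  ⟫ range-interval (2 + 2 * K) (2 + 3 * K) K (solve (K ∷ [])) (λ t s e → there (row-u∈ K (oddLow t s e)))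
  ⟫ range-point (there (row-v∈ K middleEven))
  ⟫ range-interval (3 + 3 * K) (3 + 4 * K) K (solve (K ∷ [])) (λ t s e → there (row-v∈ K (evenHigh t s e)))
  ⟫ range-point (there (row-u∈ K last))
  ⟫ range-point (there (row-v∈ K last))
  ⟫ range-interval (5 + 4 * K) (5 + 5 * K) K (solve (K ∷ []))
      (λ t s e → there (row-v∈ K (oddHigh s t (suc-+-comm t s e))))
  ⟫ range-point (there (row-u∈ K middleEven))
  ⟫ range-interval (6 + 5 * K) (6 + 6 * K) K (solve (K ∷ []))
      (λ t s e → there (row-u∈ K (evenLow s t (suc-+-comm t s e))))
  ⟫ range-point (here refl)
  ⟫ range-interval (7 + 6 * K) (7 + 7 * K) K (solve (K ∷ []))
      (λ t s e → there (row-u∈ K (evenHigh s t (suc-+-comm t s e))))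
  ⟫ range-point (there (row-v∈ K middleOdd))
  ⟫ range-interval (8 + 7 * K) (8 + 8 * K) K (solve (K ∷ []))
      (λ t s e → there (row-v∈ K (oddLow s t (suc-+-comm t s e))))
  ⟫ range-point (there (row-u∈ K first))

gaps-cover : ∀ K → Range (_∈ gapList K) 1 (9 + 8 * K)
gaps-cover K =
     range-point (row-pendant∈ K last)
  ⟫ range-pairs 2 (2 + 2 * K) K refl
      (λ t s e → row-cycle∈ K (evenHigh s t (suc-+-comm t s e)) , row-cycle∈ K (oddHigh s t (suc-+-comm t s e)))
  ⟫ range-point (row-cycle∈ K middleEven)
  ⟫ range-point (row-pendant∈ K middleEven)
  ⟫ range-pairs (4 + 2 * K) (4 + 4 * K) K (solve (K ∷ []))
      (λ t s e → row-pendant∈ K (oddHigh s t (suc-+-comm t s e)) , row-pendant∈ K (evenHigh s t (suc-+-comm t s e)))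
  ⟫ range-point (row-cycle∈ K last)
  ⟫ range-point (row-cycle∈ K middleOdd)
  ⟫ range-pairs (6 + 4 * K) (6 + 6 * K) K (solve (K ∷ []))
      (λ t s e → row-pendant∈ K (evenLow s t (suc-+-comm t s e)) , row-pendant∈ K (oddLow s t (suc-+-comm t s e)))
  ⟫ range-point (row-pendant∈ K middleOdd)
  ⟫ range-pairs (7 + 6 * K) (7 + 8 * K) K (solve (K ∷ []))
      (λ t s e → row-cycle∈ K (evenLow s t (suc-+-comm t s e)) , row-cycle∈ K (oddLow s t (suc-+-comm t s e)))
  ⟫ range-point (row-cycle∈ K first)
  ⟫ range-point (row-pendant∈ K first)

numEdges≡8k : ∀ K → numEdges (sunGraph (4 * suc K)) ≡ 8 + 8 * K
numEdges≡8k K = trans (numEdges-sunGraph (4 * suc K)) (solve (K ∷ []))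

labels↭upTo : ∀ K → 6 + 6 * K ∷ labelList K ↭ upTo (9 + 8 * K)
labels↭upTo K = ⊆∧length⇒↭ (upTo⁺ (9 + 8 * K)) (λ {L} L∈ → labels-cover K L z≤n (∈-upTo⁻ L∈)) lengths
  where
  count : 1 + (4 * suc K + 4 * suc K) ≡ 9 + 8 * K
  count = solve (K ∷ [])
  lengths : length (6 + 6 * K ∷ labelList K) ≡ length (upTo (9 + 8 * K))
  lengths = trans (cong suc (trans (length-map _ (vertices (4 * suc K))) (length-vertices (4 * suc K))))
                  (trans count (sym (length-upTo (9 + 8 * K))))

sunLabel-injective : ∀ K → Injective _≡_ _≡_ (sunLabel (suc K))
sunLabel-injective K {x} {y} = unique-map⇒injective (sunLabel (suc K)) labels-unique (∈-vertices x) (∈-vertices y)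
  where
  labels-unique : Unique (labelList K)
  labels-unique = drop⁺ 1 (Unique-resp-↭ (↭-sym (labels↭upTo K)) (upTo⁺ (9 + 8 * K)))

sunLabel-≤ : ∀ K x → sunLabel (suc K) x ≤ numEdges (sunGraph (4 * suc K))
sunLabel-≤ K x = subst (sunLabel (suc K) x ≤_) (sym (numEdges≡8k K))
  (s≤s⁻¹ (∈-upTo⁻ (∈-resp-↭ (labels↭upTo K) (there (∈-map⁺ (sunLabel (suc K)) (∈-vertices x))))))

gapList↭ : ∀ K → gapList K ↭ map suc (upTo (numEdges (sunGraph (4 * suc K))))
gapList↭ K = ⊆∧length⇒↭ (map⁺ suc-injective (upTo⁺ N)) covered lengths
  where
  N = numEdges (sunGraph (4 * suc K))
  covered : map suc (upTo N) ⊆ gapList K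
  covered d∈ with m , m∈ , refl ← ∈-map⁻ suc d∈ =
    gaps-cover K (suc m) (s≤s z≤n) (s≤s (subst (m <_) (numEdges≡8k K) (∈-upTo⁻ m∈)))
  lengths : length (gapList K) ≡ length (map suc (upTo N))
  lengths = trans (length-map _ (edges (sunGraph (4 * suc K)))) (sym (trans (length-map suc (upTo N)) (length-upTo N)))

-- The threshold

Sides : ℕ → ℕ → Set
Sides K i = Side (3 + 4 * K) (even i) (aV (suc K) i) × Side (3 + 4 * K) (not (even i)) (aU (suc K) i)

row⇒sides : ∀ {K i x x′ y p c} → Row K i x x′ y p c → Sides K i
row⇒sides ρ with vx , uy ← row-sides ρ = subst (Side _ _) (sym (row-aV ρ)) vx , subst (Side _ _) (sym (row-aU ρ)) uy

sides-2j : ∀ K j r → j + r ≡ K → Sides K (2 * j)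
sides-2j K zero    r _ = row⇒sides (first {K})
sides-2j K (suc j) r e = row⇒sides (evenLow j r e)

sides-2j+1 : ∀ K j r → j + r ≡ K → Sides K (suc (2 * j))
sides-2j+1 K j zero    e =
  subst (Sides K) (cong (λ j → suc (2 * j)) (trans (sym e) (+-identityʳ j))) (row⇒sides (middleOdd {K}))
sides-2j+1 K j (suc r) e = row⇒sides (oddLow j r (trans (sym (+-suc j r)) e))

sides-2k+2j : ∀ K j r → j + r ≡ K → Sides K (2 * (j + suc K))
sides-2k+2j K zero    r _ = row⇒sides (middleEven {K})
sides-2k+2j K (suc j) r e = row⇒sides (evenHigh j r e)

sides-2k+2j+1 : ∀ K j r → j + r ≡ K → Sides K (suc (2 * (j + suc K)))
sides-2k+2j+1 K j zero    e =
  subst (Sides K) (cong (λ j → suc (2 * (j + suc K))) (trans (sym e) (+-identityʳ j))) (row⇒sides (last {K}))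
sides-2k+2j+1 K j (suc r) e = row⇒sides (oddHigh j r (trans (sym (+-suc j r)) e))

vertex-sides : ∀ K {i} → i < 4 * suc K → Sides K i
vertex-sides K {i} i<4k with parity i
... | even-form m with half K (halve-< K m i<4k)
...   | lower j r e = sides-2j K j r e
...   | upper j r e = sides-2k+2j K j r e
vertex-sides K {i} i<4k | odd-form m with half K (halve-< K m (<-trans (n<1+n (2 * m)) i<4k))
...   | lower j r e = sides-2j+1 K j r e
...   | upper j r e = sides-2k+2j+1 K j r e

separated : ∀ {t β a b} → Side t β a → Side t (not β) b → (a ≤ t × t < b) ⊎ (b ≤ t × t < a)
separated (below d eq) (above d′ eq′) = inj₁ (≤-by d eq , ≤-by d′ eq′)
separated (above d eq) (below d′ eq′) = inj₂ (≤-by d′ eq′ , ≤-by d eq)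

threshold-≤ : ∀ K → 3 + 4 * K ≤ numEdges (sunGraph (4 * suc K))
threshold-≤ K = subst (3 + 4 * K ≤_) (sym (numEdges≡8k K)) (≤-by (5 + 4 * K) (solve (K ∷ [])))

Crosses : ∀ {V : Set} → (V → ℕ) → ℕ → V × V → Set
Crosses b t e = (b (proj₁ e) ≤ t × t < b (proj₂ e)) ⊎ (b (proj₂ e) ≤ t × t < b (proj₁ e))

edges-separated : ∀ K → All (Crosses (sunLabel (suc K)) (3 + 4 * K)) (edges (sunGraph (4 * suc K)))
edges-separated K = all-edges λ i →
  separated (proj₁ (at i)) (next-side i) , separated (proj₁ (at i)) (proj₂ (at i))
  where
  at : (i : Fin (4 * suc K)) → Sides K (toℕ i)
  at i = vertex-sides K (toℕ<n i)
  -- K + 3 * suc K is 4k − 1 in the form that Fin (4 * suc K) = Fin (suc _) exposes to cycSucc.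
  4k-1-odd : even (K + 3 * suc K) ≡ false
  4k-1-odd = trans (cong even (sym (suc-injective (1+[4k-1]≡4k K)))) (even-1+2* (K + suc K))
  next-side : (i : Fin (4 * suc K)) → Side (3 + 4 * K) (not (even (toℕ i))) (aV (suc K) (toℕ (cycSucc i)))
  next-side i = subst (λ β → Side (3 + 4 * K) β (aV (suc K) (toℕ (cycSucc i))))
                      (even-cycSucc i 4k-1-odd) (proj₁ (at (cycSucc i)))

theorem8p3 : (k : ℕ) → 1 ≤ k → IsAlphaValuation (sunGraph (4 * k)) (sunLabel k)
theorem8p3 (suc K) _ =
  (sunLabel-injective K , sunLabel-≤ K , gapList↭ K) , 3 + 4 * K , threshold-≤ K , edges-separated K
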